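{- Let $M_1=\langle Q_1,\Sigma,\delta_1,q_{0_1},F_1\rangle$ and $M_2=\langle Q_2,\Sigma,\delta_2,q_{0_2},F_2\rangle$ be finite automata recognizing languages $Init$ and $Bad$, let $\tau$ be a length-preserving finite transducer over $\Sigma$ with relation $r_\tau$, and let $\Phi$ be the first-order encoding described in the context. If $w\in r_\tau^*(Init)$, then $\Phi\vdash R(t_w)$.
   Context: A finite automaton $\langle Q,\Sigma,\delta,q_0,F\rangle$ has $\delta\subseteq Q\times\Sigma\times Q$ and accepts $w$ iff there is a run on $w$ from $q_0$ ending in $F$. A length-preserving finite transducer is $\tau=\langle Q,\Sigma,\delta,q_0,F\rangle$ with $\delta\subseteq Q\times\Sigma\times\Sigma\times Q$; $r_\tau=\{\langle w,u\rangle\mid q_0\to^{w,u}q'$ for some $q'\in F\}$, where $\to^{w,u}$ is the run relation reading $w$ and writing $u$; $r_\tau^*$ is its reflexive–transitive closure and $r_\tau^*(Init)$ the image of $Init$. The sets $Q_1,Q_2,Q,\Sigma$ are pairwise disjoint. Vocabulary: constants for all elements of $\Sigma\cup Q_1\cup Q_2\cup Q$ plus a distinct constant $e$; binary function $*$; unary $R$, $Init$, $Bad$; binary $Trans$; ternary $T^{(3)}$; 4-ary $T^{(4)}$. $\Phi$ is the set of universal closures of: (1) $(x*y)*z=x*(y*z)$; (2) $T^{(3)}(q,e,q)$ for all $q\in Q_1\cup Q_2$; (3) $T^{(3)}(q,a,q')$ for all $(q,a,q')\in\delta_1\cup\delta_2$; (4) $T^{(3)}(x,y,z)\wedge T^{(3)}(z,v,w)\to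 T^{(3)}(x,y*v,w)$; (5) $\bigvee_{q\in F_1}T^{(3)}(q_{0_1},x,q)\to Init(x)$; (6) $\bigvee_{q\in F_2}T^{(3)}(q_{0_2},x,q)\to Bad(x)$; (7) $T^{(4)}(x,e,e,x)$; (8) $T^{(4)}(q,a,b,q')$ for all $(q,a,b,q')\in\delta$; (9) $T^{(4)}(x,y,z,v)\wedge T^{(4)}(v,y',z',w)\to T^{(4)}(x,y*y',z*z',w)$; (10) $Trans(x,y)\leftrightarrow\bigvee_{q\in F}T^{(4)}(q_0,x,y,q)$; (11) $Init(x)\to R(x)$; (12) $R(x)\wedge Trans(x,y)\to R(y)$. For $w=s_1\cdots s_n$, $t_w=s_1*\cdots*s_n$ (modulo associativity; $e$ for the empty word). $\vdash$ is first-order derivability with equality. -}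

module Defs where

open import Data.Nat using (ℕ; zero; suc)
open import Data.Fin using (Fin)
open import Data.List using (List; []; _∷_; map; foldr)
open import Data.List.Membership.Propositional using (_∈_)
open import Data.Vec using (Vec) renaming ([] to []ᵛ; _∷_ to _∷ᵛ_)
import Data.Vec as Vec
open import Data.Product using (Σ; ∃; _×_; _,_)
open import Relation.Binary.Construct.Closure.ReflexiveTransitive using (Star)

record FA (s n : ℕ) : Set where
  field
    δ  : List (Fin n × Fin s × Fin n)
    q₀ : Fin n
    F  : List (Fin n)

module _ {s n : ℕ} (M : FA s n) where
  open FA M
  data Run : Fin n → List (Fin s) → Fin n → Set where
    done : ∀ {q} → Run q [] q
    step : ∀ {q a q' w q''} → (q , a , q') ∈ δ → Run q' w q'' → Run q (a ∷ w) q''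

  Accepts : List (Fin s) → Set
  Accepts w = ∃ λ q → q ∈ F × Run q₀ w q

record FT (s m : ℕ) : Set where
  field
    δ  : List (Fin m × Fin s × Fin s × Fin m)
    q₀ : Fin m
    F  : List (Fin m)

module _ {s m : ℕ} (τ : FT s m) where
  open FT τ
  data TRun : Fin m → List (Fin s) → List (Fin s) → Fin m → Set where
    done : ∀ {q} → TRun q [] [] q
    step : ∀ {q a b q' w u q''} → (q , a , b , q') ∈ δ →
           TRun q' w u q'' → TRun q (a ∷ w) (b ∷ u) q''

  r : List (Fin s) → List (Fin s) → Set
  r w u = ∃ λ q → q ∈ F × TRun q₀ w u q

Reach : ∀ {s n m} → FA s n → FT s m → List (Fin s) → Set
Reach M τ w = ∃ λ v → Accepts M v × Star (r τ) v w

-- First-order logic with equality over constants K, binary function *,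
-- and the fixed relation symbols R, Init, Bad, Trans, T⁽³⁾, T⁽⁴⁾.
-- Variables are de Bruijn indices.

data Pred : Set where
  R Init Bad Trans T3 T4 : Pred

arity : Pred → ℕ
arity R     = 1
arity Init  = 1
arity Bad   = 1
arity Trans = 2
arity T3    = 3
arity T4    = 4

infixl 7 _⊛_
data Term (K : Set) : Set where
  var : ℕ → Term K
  con : K → Term K
  _⊛_ : Term K → Term K → Term K

infix  4 _≐_
infixr 3 _∧'_
infixr 2 _∨'_
infixr 1 _⇒_
data Formula (K : Set) : Set where
  rel  : (P : Pred) → Vec (Term K) (arity P) → Formula K
  _≐_  : Term K → Term K → Formula K
  ⊥'   : Formula K
  _⇒_  : Formula K → Formula K → Formula K
  _∧'_ : Formula K → Formula K → Formula K
  _∨'_ : Formula K → Formula K → Formula K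
  ∀'   : Formula K → Formula K
  ∃'   : Formula K → Formula K

module _ {K : Set} where

  ¬' : Formula K → Formula K
  ¬' φ = φ ⇒ ⊥'

  _⇔_ : Formula K → Formula K → Formula K
  φ ⇔ ψ = (φ ⇒ ψ) ∧' (ψ ⇒ φ)

  ⋁ : List (Formula K) → Formula K
  ⋁ = foldr _∨'_ ⊥'

  ∀ⁿ : ℕ → Formula K → Formula K
  ∀ⁿ zero    φ = φ
  ∀ⁿ (suc k) φ = ∀' (∀ⁿ k φ)

  Subst : Set
  Subst = ℕ → Term K

  substT : Subst → Term K → Term K
  substT σ (var x) = σ x
  substT σ (con c) = con c
  substT σ (t ⊛ u) = substT σ t ⊛ substT σ u

  shiftT : Term K → Term K
  shiftT = substT (λ x → var (suc x))

  lift : Subst → Subst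
  lift σ zero    = var zero
  lift σ (suc x) = shiftT (σ x)

  subst : Subst → Formula K → Formula K
  subst σ (rel P ts) = rel P (Vec.map (substT σ) ts)
  subst σ (t ≐ u)    = substT σ t ≐ substT σ u
  subst σ ⊥'         = ⊥'
  subst σ (φ ⇒ ψ)    = subst σ φ ⇒ subst σ ψ
  subst σ (φ ∧' ψ)   = subst σ φ ∧' subst σ ψ
  subst σ (φ ∨' ψ)   = subst σ φ ∨' subst σ ψ
  subst σ (∀' φ)     = ∀' (subst (lift σ) φ)
  subst σ (∃' φ)     = ∃' (subst (lift σ) φ)

  shift : Formula K → Formula K
  shift = subst (λ x → var (suc x))

  _[_] : Formula K → Term K → Formula K
  φ [ t ] = subst σ φ
    where
    σ : Subst
    σ zero    = t
    σ (suc x) = var x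

  data Deriv (Φ : Formula K → Set) : List (Formula K) → Formula K → Set where
    hyp   : ∀ {Γ φ} → φ ∈ Γ → Deriv Φ Γ φ
    ax    : ∀ {Γ φ} → Φ φ → Deriv Φ Γ φ
    ⇒I    : ∀ {Γ φ ψ} → Deriv Φ (φ ∷ Γ) ψ → Deriv Φ Γ (φ ⇒ ψ)
    ⇒E    : ∀ {Γ φ ψ} → Deriv Φ Γ (φ ⇒ ψ) → Deriv Φ Γ φ → Deriv Φ Γ ψ
    ∧I    : ∀ {Γ φ ψ} → Deriv Φ Γ φ → Deriv Φ Γ ψ → Deriv Φ Γ (φ ∧' ψ)
    ∧E₁   : ∀ {Γ φ ψ} → Deriv Φ Γ (φ ∧' ψ) → Deriv Φ Γ φ
    ∧E₂   : ∀ {Γ φ ψ} → Deriv Φ Γ (φ ∧' ψ) → Deriv Φ Γ ψ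
    ∨I₁   : ∀ {Γ φ ψ} → Deriv Φ Γ φ → Deriv Φ Γ (φ ∨' ψ)
    ∨I₂   : ∀ {Γ φ ψ} → Deriv Φ Γ ψ → Deriv Φ Γ (φ ∨' ψ)
    ∨E    : ∀ {Γ φ ψ χ} → Deriv Φ Γ (φ ∨' ψ) → Deriv Φ (φ ∷ Γ) χ →
            Deriv Φ (ψ ∷ Γ) χ → Deriv Φ Γ χ
    ∀I    : ∀ {Γ φ} → Deriv Φ (map shift Γ) φ → Deriv Φ Γ (∀' φ)
    ∀E    : ∀ {Γ φ} t → Deriv Φ Γ (∀' φ) → Deriv Φ Γ (φ [ t ])
    ∃I    : ∀ {Γ φ} t → Deriv Φ Γ (φ [ t ]) → Deriv Φ Γ (∃' φ)
    ∃E    : ∀ {Γ φ ψ} → Deriv Φ Γ (∃' φ) → Deriv Φ (φ ∷ map shift Γ) (shift ψ) →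
            Deriv Φ Γ ψ
    ≐refl : ∀ {Γ} t → Deriv Φ Γ (t ≐ t)
    ≐subst : ∀ {Γ s t} φ → Deriv Φ Γ (s ≐ t) → Deriv Φ Γ (φ [ s ]) →
             Deriv Φ Γ (φ [ t ])
    raa   : ∀ {Γ φ} → Deriv Φ (¬' φ ∷ Γ) ⊥' → Deriv Φ Γ φ

  infix 2 _⊢_
  _⊢_ : (Formula K → Set) → Formula K → Set
  Φ ⊢ φ = Deriv Φ [] φ

data Const (s n₁ n₂ m : ℕ) : Set where
  sym : Fin s  → Const s n₁ n₂ m
  st₁ : Fin n₁ → Const s n₁ n₂ m
  st₂ : Fin n₂ → Const s n₁ n₂ m
  stτ : Fin m  → Const s n₁ n₂ m
  e   : Const s n₁ n₂ m

module _ {s n₁ n₂ m : ℕ} where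
  private
    Tm = Term (Const s n₁ n₂ m)
    Fm = Formula (Const s n₁ n₂ m)

  T³ : Tm → Tm → Tm → Fm
  T³ x y z = rel T3 (x ∷ᵛ y ∷ᵛ z ∷ᵛ []ᵛ)

  T⁴ : Tm → Tm → Tm → Tm → Fm
  T⁴ x y z v = rel T4 (x ∷ᵛ y ∷ᵛ z ∷ᵛ v ∷ᵛ []ᵛ)

  Rₐ Initₐ Badₐ : Tm → Fm
  Rₐ x    = rel R (x ∷ᵛ []ᵛ)
  Initₐ x = rel Init (x ∷ᵛ []ᵛ)
  Badₐ x  = rel Bad (x ∷ᵛ []ᵛ)

  Transₐ : Tm → Tm → Fm
  Transₐ x y = rel Trans (x ∷ᵛ y ∷ᵛ []ᵛ)

  ε : Tm
  ε = con e

  t : List (Fin s) → Tm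
  t []          = ε
  t (a ∷ [])    = con (sym a)
  t (a ∷ b ∷ w) = con (sym a) ⊛ t (b ∷ w)

  data Φ (M₁ : FA s n₁) (M₂ : FA s n₂) (τ : FT s m) : Fm → Set where
    ax1  : Φ M₁ M₂ τ (∀ⁿ 3 ((var 2 ⊛ var 1) ⊛ var 0 ≐ var 2 ⊛ (var 1 ⊛ var 0)))
    ax2₁ : (q : Fin n₁) → Φ M₁ M₂ τ (T³ (con (st₁ q)) ε (con (st₁ q)))
    ax2₂ : (q : Fin n₂) → Φ M₁ M₂ τ (T³ (con (st₂ q)) ε (con (st₂ q)))
    ax3₁ : ∀ {q a q'} → (q , a , q') ∈ FA.δ M₁ →
           Φ M₁ M₂ τ (T³ (con (st₁ q)) (con (sym a)) (con (st₁ q')))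
    ax3₂ : ∀ {q a q'} → (q , a , q') ∈ FA.δ M₂ →
           Φ M₁ M₂ τ (T³ (con (st₂ q)) (con (sym a)) (con (st₂ q')))
    -- x y z v w  =  var 4 … var 0
    ax4  : Φ M₁ M₂ τ (∀ⁿ 5 (T³ (var 4) (var 3) (var 2) ∧' T³ (var 2) (var 1) (var 0)
                             ⇒ T³ (var 4) (var 3 ⊛ var 1) (var 0)))
    ax5  : Φ M₁ M₂ τ (∀' (⋁ (map (λ q → T³ (con (st₁ (FA.q₀ M₁))) (var 0) (con (st₁ q)))
                                  (FA.F M₁))
                           ⇒ Initₐ (var 0)))
    ax6  : Φ M₁ M₂ τ (∀' (⋁ (map (λ q → T³ (con (st₂ (FA.q₀ M₂))) (var 0) (con (st₂ q)))
                                  (FA.F M₂))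
                           ⇒ Badₐ (var 0)))
    ax7  : Φ M₁ M₂ τ (∀' (T⁴ (var 0) ε ε (var 0)))
    ax8  : ∀ {q a b q'} → (q , a , b , q') ∈ FT.δ τ →
           Φ M₁ M₂ τ (T⁴ (con (stτ q)) (con (sym a)) (con (sym b)) (con (stτ q')))
    -- x y z v y' z' w  =  var 6 … var 0
    ax9  : Φ M₁ M₂ τ (∀ⁿ 7 (T⁴ (var 6) (var 5) (var 4) (var 3)
                               ∧' T⁴ (var 3) (var 2) (var 1) (var 0)
                             ⇒ T⁴ (var 6) (var 5 ⊛ var 2) (var 4 ⊛ var 1) (var 0)))
    ax10 : Φ M₁ M₂ τ (∀ⁿ 2 (Transₐ (var 1) (var 0)
                             ⇔ ⋁ (map (λ q → T⁴ (con (stτ (FT.q₀ τ))) (var 1) (var 0)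
                                                 (con (stτ q)))
                                     (FT.F τ))))
    ax11 : Φ M₁ M₂ τ (∀' (Initₐ (var 0) ⇒ Rₐ (var 0)))
    ax12 : Φ M₁ M₂ τ (∀ⁿ 2 (Rₐ (var 1) ∧' Transₐ (var 1) (var 0) ⇒ Rₐ (var 0)))

module Submission where

-- The proof mirrors the semantics inside the calculus.  A run q →^w q' of
-- M₁ becomes a derivation of T⁽³⁾(q, t_w, q') by induction on the run,
-- gluing single transitions (axiom 3) with the composition axiom (4);
-- likewise a run of τ becomes a derivation of T⁽⁴⁾ via axioms (7)–(9).
-- Accepting runs then give Init(t_v) by (5) and Trans(t_v, t_u) by (10),
-- so (11) starts the reachability predicate R and (12) propagates it
-- along every r_τ-step of the chain v r_τ* w.

open import Defs
open import Data.Nat using (ℕ; suc)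
open import Data.Fin using (Fin)
open import Data.List using (List; []; _∷_; map)
open import Data.List.Membership.Propositional using (_∈_)
open import Data.List.Membership.Propositional.Properties using (∈-map⁺)
open import Data.List.Relation.Unary.Any using (here; there)
open import Data.Vec using (Vec) renaming ([] to []ᵛ; _∷_ to _∷ᵛ_)
import Data.Vec.Properties as Vecₚ
open import Data.Product using (_,_)
open import Relation.Binary.Construct.Closure.ReflexiveTransitive using (Star)
  renaming (ε to reflexive; _◅_ to _then_)
open import Relation.Binary.PropositionalEquality as P using (_≡_; _≗_; refl; cong; cong₂)

module Substitution {K : Set} where

  private
    Sub = Subst {K = K}

  infixr 9 _∘ₛ_
  _∘ₛ_ : Sub → Sub → Sub
  (σ ∘ₛ ρ) x = substT σ (ρ x)

  infixr 5 _∷ₛ_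
  _∷ₛ_ : Term K → Sub → Sub
  (u ∷ₛ σ) 0       = u
  (u ∷ₛ σ) (suc x) = σ x

  substT-ext : ∀ {σ ρ : Sub} → σ ≗ ρ → substT σ ≗ substT ρ
  substT-ext σ≗ρ (var x) = σ≗ρ x
  substT-ext σ≗ρ (con c) = refl
  substT-ext σ≗ρ (u ⊛ v) = cong₂ _⊛_ (substT-ext σ≗ρ u) (substT-ext σ≗ρ v)

  substT-fusion : ∀ (σ ρ : Sub) (u : Term K) → substT σ (substT ρ u) ≡ substT (σ ∘ₛ ρ) u
  substT-fusion σ ρ (var x) = refl
  substT-fusion σ ρ (con c) = refl
  substT-fusion σ ρ (u ⊛ v) = cong₂ _⊛_ (substT-fusion σ ρ u) (substT-fusion σ ρ v)

  substT-id : ∀ (u : Term K) → substT var u ≡ u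
  substT-id (var x) = refl
  substT-id (con c) = refl
  substT-id (u ⊛ v) = cong₂ _⊛_ (substT-id u) (substT-id v)

  lift-ext : ∀ {σ ρ : Sub} → σ ≗ ρ → lift σ ≗ lift ρ
  lift-ext σ≗ρ 0       = refl
  lift-ext σ≗ρ (suc x) = cong shiftT (σ≗ρ x)

  lift-fusion : ∀ (σ ρ : Sub) → lift σ ∘ₛ lift ρ ≗ lift (σ ∘ₛ ρ)
  lift-fusion σ ρ 0       = refl
  lift-fusion σ ρ (suc x) =
    P.trans (substT-fusion (lift σ) _ (ρ x)) (P.sym (substT-fusion _ σ (ρ x)))

  lift-id : lift var ≗ var {K = K}
  lift-id 0       = refl
  lift-id (suc x) = refl

  subst-ext : ∀ {σ ρ : Sub} → σ ≗ ρ → subst σ ≗ subst ρ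
  subst-ext σ≗ρ (rel P ts) = cong (rel P) (Vecₚ.map-cong (substT-ext σ≗ρ) ts)
  subst-ext σ≗ρ (u ≐ v)    = cong₂ _≐_ (substT-ext σ≗ρ u) (substT-ext σ≗ρ v)
  subst-ext σ≗ρ ⊥'         = refl
  subst-ext σ≗ρ (φ ⇒ ψ)    = cong₂ _⇒_ (subst-ext σ≗ρ φ) (subst-ext σ≗ρ ψ)
  subst-ext σ≗ρ (φ ∧' ψ)   = cong₂ _∧'_ (subst-ext σ≗ρ φ) (subst-ext σ≗ρ ψ)
  subst-ext σ≗ρ (φ ∨' ψ)   = cong₂ _∨'_ (subst-ext σ≗ρ φ) (subst-ext σ≗ρ ψ)
  subst-ext σ≗ρ (∀' φ)     = cong ∀' (subst-ext (lift-ext σ≗ρ) φ)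
  subst-ext σ≗ρ (∃' φ)     = cong ∃' (subst-ext (lift-ext σ≗ρ) φ)

  subst-fusion : ∀ (σ ρ : Sub) (φ : Formula K) → subst σ (subst ρ φ) ≡ subst (σ ∘ₛ ρ) φ
  subst-fusion σ ρ (rel P ts) = cong (rel P) (P.trans
    (P.sym (Vecₚ.map-∘ (substT σ) (substT ρ) ts))
    (Vecₚ.map-cong (substT-fusion σ ρ) ts))
  subst-fusion σ ρ (u ≐ v)  = cong₂ _≐_ (substT-fusion σ ρ u) (substT-fusion σ ρ v)
  subst-fusion σ ρ ⊥'       = refl
  subst-fusion σ ρ (φ ⇒ ψ)  = cong₂ _⇒_ (subst-fusion σ ρ φ) (subst-fusion σ ρ ψ)
  subst-fusion σ ρ (φ ∧' ψ) = cong₂ _∧'_ (subst-fusion σ ρ φ) (subst-fusion σ ρ ψ)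
  subst-fusion σ ρ (φ ∨' ψ) = cong₂ _∨'_ (subst-fusion σ ρ φ) (subst-fusion σ ρ ψ)
  subst-fusion σ ρ (∀' φ)   = cong ∀' (P.trans (subst-fusion (lift σ) (lift ρ) φ)
                                               (subst-ext (lift-fusion σ ρ) φ))
  subst-fusion σ ρ (∃' φ)   = cong ∃' (P.trans (subst-fusion (lift σ) (lift ρ) φ)
                                               (subst-ext (lift-fusion σ ρ) φ))

  subst-id : ∀ (φ : Formula K) → subst var φ ≡ φ
  subst-id (rel P ts) = cong (rel P) (P.trans (Vecₚ.map-cong substT-id ts) (Vecₚ.map-id ts))
  subst-id (u ≐ v)    = cong₂ _≐_ (substT-id u) (substT-id v)
  subst-id ⊥'         = refl
  subst-id (φ ⇒ ψ)    = cong₂ _⇒_ (subst-id φ) (subst-id ψ)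
  subst-id (φ ∧' ψ)   = cong₂ _∧'_ (subst-id φ) (subst-id ψ)
  subst-id (φ ∨' ψ)   = cong₂ _∨'_ (subst-id φ) (subst-id ψ)
  subst-id (∀' φ)     = cong ∀' (P.trans (subst-ext lift-id φ) (subst-id φ))
  subst-id (∃' φ)     = cong ∃' (P.trans (subst-ext lift-id φ) (subst-id φ))

  instantiate-as-subst : ∀ (u : Term K) (φ : Formula K) → φ [ u ] ≡ subst (u ∷ₛ var) φ
  instantiate-as-subst u φ = subst-ext (λ { 0 → refl ; (suc x) → refl }) φ

  extend-after-lift : ∀ (σ : Sub) (u : Term K) → (u ∷ₛ var) ∘ₛ lift σ ≗ u ∷ₛ σ
  extend-after-lift σ u 0       = refl
  extend-after-lift σ u (suc x) =
    P.trans (substT-fusion (u ∷ₛ var) _ (σ x)) (substT-id (σ x))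

  -- Instantiating the binder of ∀'(φ under lift σ) by u extends σ by u.
  -- No closedness of u is needed: lift shifts σ exactly so that the
  -- instantiation [ u ] undoes the shift.
  instantiate-lift : ∀ (σ : Sub) (u : Term K) (φ : Formula K) →
                     subst (lift σ) φ [ u ] ≡ subst (u ∷ₛ σ) φ
  instantiate-lift σ u φ = begin
    subst (lift σ) φ [ u ]                ≡⟨ instantiate-as-subst u (subst (lift σ) φ) ⟩
    subst (u ∷ₛ var) (subst (lift σ) φ)   ≡⟨ subst-fusion (u ∷ₛ var) (lift σ) φ ⟩
    subst ((u ∷ₛ var) ∘ₛ lift σ) φ        ≡⟨ subst-ext (extend-after-lift σ u) φ ⟩
    subst (u ∷ₛ σ) φ                      ∎
    where open P.≡-Reasoning

  -- Extend σ by u₁, …, u_k in turn; u_k ends up as variable 0.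
  extend : ∀ {k} → Vec (Term K) k → Sub → Sub
  extend []ᵛ        σ = σ
  extend (u ∷ᵛ us) σ = extend us (u ∷ₛ σ)

  ⟨_⟩ : ∀ {k} → Vec (Term K) k → Sub
  ⟨ us ⟩ = extend us var

open Substitution using (⟨_⟩)

module DerivedRules {K : Set} {Φ : Formula K → Set} {Γ : List (Formula K)} where
  open Substitution

  private
    Sub = Subst {K = K}
    _⊩_ : List (Formula K) → Formula K → Set
    _⊩_ = Deriv Φ

  transport : ∀ {φ ψ} → φ ≡ ψ → Γ ⊩ φ → Γ ⊩ ψ
  transport = P.subst (Γ ⊩_)

  -- Universal instantiation of a k-fold closure, outermost binder first.
  ∀ⁿ-elim : ∀ {k} (us : Vec (Term K) k) {φ : Formula K} →
            Γ ⊩ ∀ⁿ k φ → Γ ⊩ subst ⟨ us ⟩ φ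
  ∀ⁿ-elim us {φ} d = go us (transport (P.sym (subst-id (∀ⁿ _ φ))) d)
    where
    -- Invariant: the binders already instantiated are recorded in σ.
    go : ∀ {k} (us : Vec (Term K) k) {σ} → Γ ⊩ subst σ (∀ⁿ k φ) → Γ ⊩ subst (extend us σ) φ
    go []ᵛ        d = d
    go (u ∷ᵛ us) {σ} d = go us (transport (instantiate-lift σ u _) (∀E u d))

  subst-⋁ : ∀ (σ : Sub) (φs : List (Formula K)) → subst σ (⋁ φs) ≡ ⋁ (map (subst σ) φs)
  subst-⋁ σ []       = refl
  subst-⋁ σ (φ ∷ φs) = cong (subst σ φ ∨'_) (subst-⋁ σ φs)

  ⋁-intro : ∀ {φ φs} → φ ∈ φs → Γ ⊩ φ → Γ ⊩ ⋁ φs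
  ⋁-intro (here refl) d = ∨I₁ d
  ⋁-intro (there φ∈)  d = ∨I₂ (⋁-intro φ∈ d)

  ⋁-map-intro : ∀ {A : Set} (σ : Sub) (g : A → Formula K) {F : List A} {q : A} →
                q ∈ F → Γ ⊩ subst σ (g q) → Γ ⊩ subst σ (⋁ (map g F))
  ⋁-map-intro σ g {F} q∈F d =
    transport (P.sym (subst-⋁ σ (map g F))) (⋁-intro (∈-map⁺ (subst σ) (∈-map⁺ g q∈F)) d)

module Soundness {s n₁ n₂ m : ℕ} (M₁ : FA s n₁) (M₂ : FA s n₂) (τ : FT s m) where
  open DerivedRules

  private
    Tm = Term (Const s n₁ n₂ m)
    Fm = Formula (Const s n₁ n₂ m)

  ⊢_ : Fm → Set
  ⊢ φ = Φ M₁ M₂ τ ⊢ φ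

  T³-compose : ∀ {x y z v w : Tm} → ⊢ T³ x y z → ⊢ T³ z v w → ⊢ T³ x (y ⊛ v) w
  T³-compose {x} {y} {z} {v} {w} d₁ d₂ =
    ⇒E (∀ⁿ-elim (x ∷ᵛ y ∷ᵛ z ∷ᵛ v ∷ᵛ w ∷ᵛ []ᵛ) (ax ax4)) (∧I d₁ d₂)

  T⁴-compose : ∀ {x y z v y' z' w : Tm} →
               ⊢ T⁴ x y z v → ⊢ T⁴ v y' z' w → ⊢ T⁴ x (y ⊛ y') (z ⊛ z') w
  T⁴-compose {x} {y} {z} {v} {y'} {z'} {w} d₁ d₂ =
    ⇒E (∀ⁿ-elim (x ∷ᵛ y ∷ᵛ z ∷ᵛ v ∷ᵛ y' ∷ᵛ z' ∷ᵛ w ∷ᵛ []ᵛ) (ax ax9)) (∧I d₁ d₂)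

  run⇒T³ : ∀ {q w q'} → Run M₁ q w q' → ⊢ T³ (con (st₁ q)) (t w) (con (st₁ q'))
  run⇒T³ {q} done                   = ax (ax2₁ q)
  run⇒T³ (step a∈δ done)            = ax (ax3₁ a∈δ)
  run⇒T³ (step a∈δ run@(step _ _)) = T³-compose (ax (ax3₁ a∈δ)) (run⇒T³ run)

  trun⇒T⁴ : ∀ {q w u q'} → TRun τ q w u q' →
            ⊢ T⁴ (con (stτ q)) (t w) (t u) (con (stτ q'))
  trun⇒T⁴ {q} done                    = ∀ⁿ-elim (con (stτ q) ∷ᵛ []ᵛ) (ax ax7)
  trun⇒T⁴ (step ab∈δ done)            = ax (ax8 ab∈δ)
  trun⇒T⁴ (step ab∈δ run@(step _ _)) = T⁴-compose (ax (ax8 ab∈δ)) (trun⇒T⁴ run)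

  accepts⇒Init : ∀ {v} → Accepts M₁ v → ⊢ Initₐ (t v)
  accepts⇒Init {v} (q , q∈F , run) =
    ⇒E (∀ⁿ-elim (t v ∷ᵛ []ᵛ) (ax ax5))
       (⋁-map-intro ⟨ t v ∷ᵛ []ᵛ ⟩ _ q∈F (run⇒T³ run))

  r⇒Trans : ∀ {v u} → r τ v u → ⊢ Transₐ (t v) (t u)
  r⇒Trans {v} {u} (q , q∈F , run) =
    ⇒E (∧E₂ (∀ⁿ-elim (t v ∷ᵛ t u ∷ᵛ []ᵛ) (ax ax10)))
       (⋁-map-intro ⟨ t v ∷ᵛ t u ∷ᵛ []ᵛ ⟩ _ q∈F (trun⇒T⁴ run))

  Init⇒R : ∀ {v} → ⊢ Initₐ (t v) → ⊢ Rₐ (t v)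
  Init⇒R {v} d = ⇒E (∀ⁿ-elim (t v ∷ᵛ []ᵛ) (ax ax11)) d

  R-step : ∀ {v u} → ⊢ Rₐ (t v) → ⊢ Transₐ (t v) (t u) → ⊢ Rₐ (t u)
  R-step {v} {u} dR dT = ⇒E (∀ⁿ-elim (t v ∷ᵛ t u ∷ᵛ []ᵛ) (ax ax12)) (∧I dR dT)

  R-star : ∀ {v w} → ⊢ Rₐ (t v) → Star (r τ) v w → ⊢ Rₐ (t w)
  R-star dR reflexive         = dR
  R-star dR (vru then u↝w) = R-star (R-step dR (r⇒Trans vru)) u↝w

proposition4 : ∀ {s n₁ n₂ m : ℕ} (M₁ : FA s n₁) (M₂ : FA s n₂) (τ : FT s m)
                 (w : List (Fin s)) →
                 Reach M₁ τ w →
                 Φ M₁ M₂ τ ⊢ Rₐ (t w)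
proposition4 M₁ M₂ τ w (v , v∈Init , v↝w) =
  R-star (Init⇒R (accepts⇒Init v∈Init)) v↝w
  where open Soundness M₁ M₂ τ
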